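{- Let $p,q,r,a,b,c$ be real numbers with $c\neq 0$, let $(P_n)_{n\in\mathbb{Z}}=\mathcal{P}(x)(p,q,r;a,b,c)$ and $(U_n)_{n\in\mathbb{Z}}=\mathcal{P}(x)(0,0,1;a,b,c)$, and let $\Delta_{\mathcal{P}}=(q^2-apq)x^2+(2qr-apr-bpq)x+(r^2-bpr-cp^2)$. Then for all integers $s,i,j$, \[ P_j P_1 - P_0 P_{j+1} = \Delta_{\mathcal{P}}\, U_j, \qquad P_{s+i}P_{s+j}-P_sP_{s+i+j} = (-c)^s\,\Delta_{\mathcal{P}}\, U_i U_j. \]
   Context: For real numbers $p,q,r,a,b,c$ with $c\neq 0$, $\mathcal{P}(x)(p,q,r;a,b,c)=(P_n)_{n\in\mathbb{Z}}$ denotes the sequence of polynomials in $x$ defined by $P_0=p$, $P_1=qx+r$, $P_{n+2}=(ax+b)P_{n+1}+cP_n$ for $n\ge 0$, and for $n<0$ by $P_n=-\frac{ax+b}{c}P_{n+1}+\frac{1}{c}P_{n+2}$. Thus $(U_n)=\mathcal{P}(x)(0,0,1;a,b,c)$ has $U_0=0$, $U_1=1$. The polynomial $\Delta_{\mathcal{P}}$ is called the discriminant of the sequence. -}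

module Defs where

open import Algebra.Bundles using (CommutativeRing)
open import Data.Nat using (ℕ; zero; suc)
open import Data.Integer using (ℤ; +_; -[1+_])
open import Data.Product using (_×_; _,_; proj₁)

-- The sequence P(x)(p,q,r;a,b,c) evaluated in a commutative ring R at an
-- element x, where cinv is a (two-sided) inverse of c.
module _ {ℓ₁ ℓ₂} (R : CommutativeRing ℓ₁ ℓ₂) where
  open CommutativeRing R hiding (zero)

  pow : Carrier → ℕ → Carrier
  pow u zero    = 1#
  pow u (suc n) = u * pow u n

  zpow : (u uinv : Carrier) → ℤ → Carrier
  zpow u uinv (+ n)     = pow u n
  zpow u uinv -[1+ n ]  = pow uinv (suc n)

  module _ (p q r a b c cinv x : Carrier) where
    -- forward pairs (P_n , P_{n+1}) for n ≥ 0
    fwd : ℕ → Carrier × Carrier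
    fwd zero    = p , (q * x + r)
    fwd (suc n) with fwd n
    ... | (u , v) = v , ((a * x + b) * v + c * u)

    -- backward pairs (P_{-n} , P_{-n+1}) for n ≥ 0, using
    -- P_n = -((ax+b)/c) P_{n+1} + (1/c) P_{n+2}
    bwd : ℕ → Carrier × Carrier
    bwd zero    = fwd zero
    bwd (suc n) with bwd n
    ... | (u , v) = ((- ((a * x + b) * cinv)) * u + cinv * v) , u

    seqP : ℤ → Carrier
    seqP (+ n)     = proj₁ (fwd n)
    seqP -[1+ n ]  = proj₁ (bwd (suc n))

-- For fixed x, n ↦ P_n solves f (k + 2) = (a x + b) f (k + 1) + c f k, and since c is
-- invertible a solution is determined by two consecutive values. For fixed s and i, the
-- left-hand side of the second identity is a solution in j vanishing at j = 0, hence equal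
-- to its value at j = 1 times U_j; that value is a solution in i vanishing at i = 0, hence
-- equal to U_i times P_{s+1}² − P_s P_{s+2}. This Cassini term is multiplied by −c when s
-- increases by one, and equals Δ at s = 0. The first identity is the case s = 0, i = j, j = 1.
module Submission where

open import Algebra.Bundles using (CommutativeRing)
import Algebra.Solver.Ring
open import Algebra.Solver.Ring.AlmostCommutativeRing using (fromCommutativeRing; _-Raw-AlmostCommutative⟶_)
open import Data.Integer.Base as ℤ using (ℤ; +_; -[1+_]) renaming (suc to sucℤ)
import Data.Integer.Properties as ℤ
open import Data.Maybe.Base using (Maybe; just; nothing)
open import Data.Nat.Base as ℕ using (zero; suc)
import Data.Nat.Properties as ℕ
open import Data.Product.Base using (_×_; _,_; proj₁)
open import Data.Sign.Base as Sign using (Sign)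
open import Relation.Binary.PropositionalEquality using (_≡_; cong; cong₂)
import Relation.Binary.PropositionalEquality as ≡
open import Relation.Nullary.Decidable.Core using (yes; no)

open import Defs

-- Normal forms with coefficients in an abstract ring cannot be compared by evaluation, so
-- coefficients are taken in ℤ through its canonical map to R.
module IntegerCoefficientSolver {ℓ₁ ℓ₂} (R : CommutativeRing ℓ₁ ℓ₂) where
  open CommutativeRing R
  open import Algebra.Properties.Ring ring using (-0#≈0#; -‿involutive; -1*x≈-x)
  open import Algebra.Properties.AbelianGroup +-abelianGroup using (⁻¹-∙-comm)
  open import Algebra.Properties.CommutativeSemigroup *-commutativeSemigroup using (interchange)
  open import Algebra.Properties.Semiring.Mult.TCOptimised semiring
    using (1+×; ×-homo-+; ×1-homo-*) renaming (_×_ to _×ₙ_)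
  open import Relation.Binary.Reasoning.Setoid setoid

  ⟦_⟧ : ℤ → Carrier
  ⟦ + n ⟧      = n ×ₙ 1#
  ⟦ -[1+ n ] ⟧ = - (suc n ×ₙ 1#)

  ⟦⟧-homo‿- : ∀ i → ⟦ ℤ.- i ⟧ ≈ - ⟦ i ⟧
  ⟦⟧-homo‿- (+ zero)  = sym -0#≈0#
  ⟦⟧-homo‿- (+ suc n) = refl
  ⟦⟧-homo‿- -[1+ n ]  = sym (-‿involutive _)

  [a+x]-[a+y]≈x-y : ∀ a x y → (a + x) - (a + y) ≈ x - y
  [a+x]-[a+y]≈x-y a x y = begin
    (a + x) - (a + y)       ≈⟨ +-congˡ (⁻¹-∙-comm a y) ⟨
    (a + x) + (- a + - y)   ≈⟨ +-congʳ (+-comm a x) ⟩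
    (x + a) + (- a + - y)   ≈⟨ +-assoc x a _ ⟩
    x + (a + (- a + - y))   ≈⟨ +-congˡ (+-assoc a (- a) (- y)) ⟨
    x + ((a - a) + - y)     ≈⟨ +-congˡ (+-congʳ (-‿inverseʳ a)) ⟩
    x + (0# + - y)          ≈⟨ +-congˡ (+-identityˡ (- y)) ⟩
    x - y                   ∎

  ⟦⟧-homo-⊖ : ∀ m n → ⟦ m ℤ.⊖ n ⟧ ≈ m ×ₙ 1# - n ×ₙ 1#
  ⟦⟧-homo-⊖ zero    zero    = sym (trans (+-congˡ -0#≈0#) (+-identityʳ 0#))
  ⟦⟧-homo-⊖ zero    (suc n) = sym (+-identityˡ _)
  ⟦⟧-homo-⊖ (suc m) zero    = sym (trans (+-congˡ -0#≈0#) (+-identityʳ _))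
  ⟦⟧-homo-⊖ (suc m) (suc n) = begin
    ⟦ suc m ℤ.⊖ suc n ⟧                 ≡⟨ cong ⟦_⟧ (ℤ.[1+m]⊖[1+n]≡m⊖n m n) ⟩
    ⟦ m ℤ.⊖ n ⟧                         ≈⟨ ⟦⟧-homo-⊖ m n ⟩
    m ×ₙ 1# - n ×ₙ 1#                   ≈⟨ [a+x]-[a+y]≈x-y 1# _ _ ⟨
    (1# + m ×ₙ 1#) - (1# + n ×ₙ 1#)     ≈⟨ +-cong (1+× m 1#) (-‿cong (1+× n 1#)) ⟨
    suc m ×ₙ 1# - suc n ×ₙ 1#           ∎

  ⟦⟧-homo-+ : ∀ i j → ⟦ i ℤ.+ j ⟧ ≈ ⟦ i ⟧ + ⟦ j ⟧
  ⟦⟧-homo-+ (+ m)    (+ n)    = ×-homo-+ 1# m n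
  ⟦⟧-homo-+ (+ m)    -[1+ n ] = ⟦⟧-homo-⊖ m (suc n)
  ⟦⟧-homo-+ -[1+ m ] (+ n)    = trans (⟦⟧-homo-⊖ n (suc m)) (+-comm _ _)
  ⟦⟧-homo-+ -[1+ m ] -[1+ n ] = begin
    - (suc (suc (m ℕ.+ n)) ×ₙ 1#)       ≡⟨ cong (λ k → - (k ×ₙ 1#)) (ℕ.+-suc (suc m) n) ⟨
    - ((suc m ℕ.+ suc n) ×ₙ 1#)         ≈⟨ -‿cong (×-homo-+ 1# (suc m) (suc n)) ⟩
    - (suc m ×ₙ 1# + suc n ×ₙ 1#)       ≈⟨ ⁻¹-∙-comm _ _ ⟨
    - (suc m ×ₙ 1#) + - (suc n ×ₙ 1#)   ∎

  signed : Sign → Carrier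
  signed Sign.+ = 1#
  signed Sign.- = - 1#

  signed-homo-* : ∀ s t → signed (s Sign.* t) ≈ signed s * signed t
  signed-homo-* Sign.+ t      = sym (*-identityˡ _)
  signed-homo-* Sign.- Sign.+ = sym (*-identityʳ _)
  signed-homo-* Sign.- Sign.- = sym (trans (-1*x≈-x (- 1#)) (-‿involutive 1#))

  ⟦◃⟧ : ∀ s n → ⟦ s ℤ.◃ n ⟧ ≈ signed s * (n ×ₙ 1#)
  ⟦◃⟧ s      zero    = sym (zeroʳ _)
  ⟦◃⟧ Sign.+ (suc n) = sym (*-identityˡ _)
  ⟦◃⟧ Sign.- (suc n) = sym (-1*x≈-x _)

  ⟦⟧≈sign*abs : ∀ i → ⟦ i ⟧ ≈ signed (ℤ.sign i) * (ℤ.∣ i ∣ ×ₙ 1#)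
  ⟦⟧≈sign*abs (+ n)    = sym (*-identityˡ _)
  ⟦⟧≈sign*abs -[1+ n ] = sym (-1*x≈-x _)

  ⟦⟧-homo-* : ∀ i j → ⟦ i ℤ.* j ⟧ ≈ ⟦ i ⟧ * ⟦ j ⟧
  ⟦⟧-homo-* i j = begin
    ⟦ i ℤ.* j ⟧
      ≈⟨ ⟦◃⟧ (ℤ.sign i Sign.* ℤ.sign j) (ℤ.∣ i ∣ ℕ.* ℤ.∣ j ∣) ⟩
    signed (ℤ.sign i Sign.* ℤ.sign j) * ((ℤ.∣ i ∣ ℕ.* ℤ.∣ j ∣) ×ₙ 1#)
      ≈⟨ *-cong (signed-homo-* (ℤ.sign i) (ℤ.sign j)) (×1-homo-* ℤ.∣ i ∣ ℤ.∣ j ∣) ⟩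
    (signed (ℤ.sign i) * signed (ℤ.sign j)) * ((ℤ.∣ i ∣ ×ₙ 1#) * (ℤ.∣ j ∣ ×ₙ 1#))
      ≈⟨ interchange _ _ _ _ ⟩
    (signed (ℤ.sign i) * (ℤ.∣ i ∣ ×ₙ 1#)) * (signed (ℤ.sign j) * (ℤ.∣ j ∣ ×ₙ 1#))
      ≈⟨ *-cong (⟦⟧≈sign*abs i) (⟦⟧≈sign*abs j) ⟨
    ⟦ i ⟧ * ⟦ j ⟧
      ∎

  ℤ⟶R : ℤ.+-*-rawRing -Raw-AlmostCommutative⟶ fromCommutativeRing R
  ℤ⟶R = record
    { ⟦_⟧ = ⟦_⟧ ; +-homo = ⟦⟧-homo-+ ; *-homo = ⟦⟧-homo-* ; -‿homo = ⟦⟧-homo‿-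
    ; 0-homo = refl ; 1-homo = refl }

  ⟦⟧-≟ : ∀ i j → Maybe (⟦ i ⟧ ≈ ⟦ j ⟧)
  ⟦⟧-≟ i j with i ℤ.≟ j
  ... | yes ≡.refl = just refl
  ... | no _       = nothing

  open Algebra.Solver.Ring ℤ.+-*-rawRing (fromCommutativeRing R) ℤ⟶R ⟦⟧-≟ public
    using (solve; _:=_; _:+_; _:-_; _:*_; :-_; con)

+-sucʳ : ∀ t k → t ℤ.+ sucℤ k ≡ sucℤ (t ℤ.+ k)
+-sucʳ t k = x∙yz≈y∙xz t (+ 1) k
  where open import Algebra.Properties.CommutativeSemigroup ℤ.+-commutativeSemigroup using (x∙yz≈y∙xz)

+1≡sucℤ : ∀ k → k ℤ.+ + 1 ≡ sucℤ k
+1≡sucℤ k = ℤ.+-comm k (+ 1)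

module Recurrences {ℓ₁ ℓ₂} (R : CommutativeRing ℓ₁ ℓ₂) where
  open CommutativeRing R hiding (zero)
  open import Algebra.Properties.Group +-group using (x∙y⁻¹≈ε⇒x≈y)
  open import Relation.Binary.Reasoning.Setoid setoid
  open IntegerCoefficientSolver R using (solve; _:=_; _:+_; _:-_; _:*_; :-_; con)

  x*y-y*x≈0 : ∀ x y → x * y - y * x ≈ 0#
  x*y-y*x≈0 x y = trans (+-congˡ (-‿cong (*-comm y x))) (-‿inverseʳ (x * y))

  module _ {m m⁻¹ : Carrier} (m*m⁻¹≈1 : m * m⁻¹ ≈ 1#) {g : ℤ → Carrier}
           (g-step : ∀ k → g (sucℤ k) ≈ m * g k) where

    private
      g-unstep : ∀ k → g k ≈ m⁻¹ * g (sucℤ k)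
      g-unstep k = begin
        g k                 ≈⟨ *-identityˡ (g k) ⟨
        1# * g k            ≈⟨ *-congʳ (trans (*-comm m⁻¹ m) m*m⁻¹≈1) ⟨
        (m⁻¹ * m) * g k     ≈⟨ *-assoc m⁻¹ m (g k) ⟩
        m⁻¹ * (m * g k)     ≈⟨ *-congˡ (g-step k) ⟨
        m⁻¹ * g (sucℤ k)    ∎

      x≈y*z⇒w*x≈w*y*z : ∀ {w x y z} → x ≈ y * z → w * x ≈ (w * y) * z
      x≈y*z⇒w*x≈w*y*z {w} x≈y*z = trans (*-congˡ x≈y*z) (sym (*-assoc w _ _))

    ratio⇒≈zpow : ∀ k → g k ≈ zpow R m m⁻¹ k * g (+ 0)
    ratio⇒≈zpow (+ zero)     = sym (*-identityˡ (g (+ 0)))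
    ratio⇒≈zpow (+ suc n)    = trans (g-step (+ n)) (x≈y*z⇒w*x≈w*y*z (ratio⇒≈zpow (+ n)))
    ratio⇒≈zpow -[1+ zero ]  = trans (g-unstep -[1+ 0 ]) (x≈y*z⇒w*x≈w*y*z (ratio⇒≈zpow (+ 0)))
    ratio⇒≈zpow -[1+ suc n ] = trans (g-unstep -[1+ suc n ]) (x≈y*z⇒w*x≈w*y*z (ratio⇒≈zpow -[1+ n ]))

  module _ (L c : Carrier) where

    Recurrent : (ℤ → Carrier) → Set ℓ₂
    Recurrent f = ∀ k → f (sucℤ (sucℤ k)) ≈ L * f (sucℤ k) + c * f k

    recurrent-*ˡ : ∀ α {f} → Recurrent f → Recurrent (λ k → α * f k)
    recurrent-*ˡ α {f} rf k = trans (*-congˡ (rf k))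
      (solve 5 (λ α L c u v → α :* (L :* u :+ c :* v) := (L :* (α :* u) :+ c :* (α :* v)))
             refl α L c (f (sucℤ k)) (f k))

    recurrent-*ʳ : ∀ α {f} → Recurrent f → Recurrent (λ k → f k * α)
    recurrent-*ʳ α {f} rf k = trans (*-congʳ (rf k))
      (solve 5 (λ α L c u v → (L :* u :+ c :* v) :* α := (L :* (u :* α) :+ c :* (v :* α)))
             refl α L c (f (sucℤ k)) (f k))

    recurrent-− : ∀ {f g} → Recurrent f → Recurrent g → Recurrent (λ k → f k - g k)
    recurrent-− {f} {g} rf rg k = trans (+-cong (rf k) (-‿cong (rg k)))
      (solve 6 (λ L c u v u′ v′ → ((L :* u :+ c :* v) :- (L :* u′ :+ c :* v′))
                                  := (L :* (u :- u′) :+ c :* (v :- v′)))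
             refl L c (f (sucℤ k)) (f k) (g (sucℤ k)) (g k))

    recurrent-reindex : ∀ {f} (σ : ℤ → ℤ) → (∀ k → σ (sucℤ k) ≡ sucℤ (σ k)) →
                        Recurrent f → Recurrent (λ k → f (σ k))
    recurrent-reindex {f} σ σ-suc rf k = begin
      f (σ (sucℤ (sucℤ k)))                ≡⟨ cong f (≡.trans (σ-suc (sucℤ k)) (cong sucℤ (σ-suc k))) ⟩
      f (sucℤ (sucℤ (σ k)))                ≈⟨ rf (σ k) ⟩
      L * f (sucℤ (σ k)) + c * f (σ k)     ≡⟨ cong (λ i → L * f i + c * f (σ k)) (σ-suc k) ⟨
      L * f (σ (sucℤ k)) + c * f (σ k)     ∎

    recurrent-shift : ∀ t {f} → Recurrent f → Recurrent (λ k → f (t ℤ.+ k))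
    recurrent-shift t = recurrent-reindex (λ k → t ℤ.+ k) (+-sucʳ t)

    recurrent-+1 : ∀ {f} → Recurrent f → Recurrent (λ k → f (k ℤ.+ + 1))
    recurrent-+1 = recurrent-reindex (λ k → k ℤ.+ + 1) (λ k → ℤ.+-assoc (+ 1) k (+ 1))

    cassini : (ℤ → Carrier) → ℤ → Carrier
    cassini f s = f (sucℤ s) * f (sucℤ s) - f s * f (sucℤ (sucℤ s))

    -- Eliminating f (s+2) and f (s+3) by the recurrence turns this into a polynomial identity.
    cassini-step : ∀ {f} → Recurrent f → ∀ s → cassini f (sucℤ s) ≈ (- c) * cassini f s
    cassini-step {f} rf s = begin
      C * C - B * f (sucℤ (sucℤ (sucℤ s)))      ≈⟨ +-congˡ (-‿cong (*-congˡ (rf (sucℤ s)))) ⟩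
      C * C - B * (L * C + c * B)                ≈⟨ +-cong (*-cong C≈ C≈) (-‿cong (*-congˡ (+-congʳ (*-congˡ C≈)))) ⟩
      C′ * C′ - B * (L * C′ + c * B)             ≈⟨ solve 4 (λ L c A B →
                                                      ((L :* B :+ c :* A) :* (L :* B :+ c :* A) :- (B :* (L :* (L :* B :+ c :* A) :+ c :* B)))
                                                      := :- c :* (B :* B :- (A :* (L :* B :+ c :* A))))
                                                      refl L c A B ⟩
      (- c) * (B * B - A * C′)                   ≈⟨ *-congˡ (+-congˡ (-‿cong (*-congˡ C≈))) ⟨
      (- c) * (B * B - A * C)                    ∎
      where
      A = f s
      B = f (sucℤ s)
      C = f (sucℤ (sucℤ s))
      C′ = L * B + c * A
      C≈ : C ≈ C′
      C≈ = rf s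

    module _ {c⁻¹ : Carrier} (c*c⁻¹≈1 : c * c⁻¹ ≈ 1#) where

      cassini≈zpow : ∀ {f} → Recurrent f → ∀ s → cassini f s ≈ zpow R (- c) (- c⁻¹) s * cassini f (+ 0)
      cassini≈zpow rf = ratio⇒≈zpow (trans (solve 2 (λ c c⁻¹ → :- c :* :- c⁻¹ := c :* c⁻¹) refl c c⁻¹) c*c⁻¹≈1)
                                  (cassini-step rf)

      private
        vanishes-forward : ∀ {f} → Recurrent f → ∀ {k} → f k ≈ 0# → f (sucℤ k) ≈ 0# → f (sucℤ (sucℤ k)) ≈ 0#
        vanishes-forward {f} rf {k} f₀ f₁ = begin
          f (sucℤ (sucℤ k))           ≈⟨ rf k ⟩
          L * f (sucℤ k) + c * f k    ≈⟨ +-cong (*-congˡ f₁) (*-congˡ f₀) ⟩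
          L * 0# + c * 0#             ≈⟨ +-cong (zeroʳ L) (zeroʳ c) ⟩
          0# + 0#                     ≈⟨ +-identityʳ 0# ⟩
          0#                          ∎

        vanishes-backward : ∀ {f} → Recurrent f → ∀ {k} → f (sucℤ k) ≈ 0# → f (sucℤ (sucℤ k)) ≈ 0# → f k ≈ 0#
        vanishes-backward {f} rf {k} f₁ f₂ = begin
          f k                         ≈⟨ *-identityˡ (f k) ⟨
          1# * f k                    ≈⟨ *-congʳ (trans (*-comm c⁻¹ c) c*c⁻¹≈1) ⟨
          (c⁻¹ * c) * f k             ≈⟨ *-assoc c⁻¹ c (f k) ⟩
          c⁻¹ * (c * f k)             ≈⟨ *-congˡ c*f≈0 ⟩
          c⁻¹ * 0#                    ≈⟨ zeroʳ c⁻¹ ⟩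
          0#                          ∎
          where
          c*f≈0 : c * f k ≈ 0#
          c*f≈0 = begin
            c * f k                     ≈⟨ +-identityˡ (c * f k) ⟨
            0# + c * f k                ≈⟨ +-congʳ (trans (*-congˡ f₁) (zeroʳ L)) ⟨
            L * f (sucℤ k) + c * f k    ≈⟨ rf k ⟨
            f (sucℤ (sucℤ k))           ≈⟨ f₂ ⟩
            0#                          ∎

      recurrent-≈0 : ∀ {f} → Recurrent f → f (+ 0) ≈ 0# → f (+ 1) ≈ 0# → ∀ k → f k ≈ 0#
      recurrent-≈0 {f} rf f₀ f₁ (+ n)    = proj₁ (forward n)
        where
        forward : ∀ n → f (+ n) ≈ 0# × f (+ suc n) ≈ 0#
        forward zero    = f₀ , f₁
        forward (suc n) = let e₀ , e₁ = forward n in e₁ , vanishes-forward rf e₀ e₁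
      recurrent-≈0 {f} rf f₀ f₁ -[1+ n ] = proj₁ (backward n)
        where
        backward : ∀ n → f -[1+ n ] ≈ 0# × f (sucℤ -[1+ n ]) ≈ 0#
        backward zero    = vanishes-backward rf f₀ f₁ , f₀
        backward (suc n) = let e₁ , e₂ = backward n in vanishes-backward rf e₁ e₂ , e₁

      module _ {U} (U-rec : Recurrent U) (U₀ : U (+ 0) ≈ 0#) (U₁ : U (+ 1) ≈ 1#) where

        vanishing-at-0⇒≈*U : ∀ {g} → Recurrent g → g (+ 0) ≈ 0# → ∀ k → g k ≈ g (+ 1) * U k
        vanishing-at-0⇒≈*U {g} rg g₀ k = x∙y⁻¹≈ε⇒x≈y (g k) (g (+ 1) * U k)
          (recurrent-≈0 (recurrent-− rg (recurrent-*ˡ (g (+ 1)) U-rec)) h₀ h₁ k)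
          where
          h₀ : g (+ 0) - g (+ 1) * U (+ 0) ≈ 0#
          h₀ = trans (+-cong g₀ (-‿cong (trans (*-congˡ U₀) (zeroʳ _)))) (-‿inverseʳ 0#)
          h₁ : g (+ 1) - g (+ 1) * U (+ 1) ≈ 0#
          h₁ = trans (+-congˡ (-‿cong (trans (*-congˡ U₁) (*-identityʳ _)))) (-‿inverseʳ _)

        catalan : ∀ {f} → Recurrent f → ∀ s i j →
                  f (s ℤ.+ i) * f (s ℤ.+ j) - f s * f (s ℤ.+ i ℤ.+ j) ≈ cassini f s * U i * U j
        catalan {f} rf s i j =
          trans (vanishing-at-0⇒≈*U in-j in-j₀ j)
                (*-congʳ (trans (vanishing-at-0⇒≈*U in-i in-i₀ i) (*-congʳ in-i₁)))
          where
          in-j : Recurrent (λ j → f (s ℤ.+ i) * f (s ℤ.+ j) - f s * f (s ℤ.+ i ℤ.+ j))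
          in-j = recurrent-− (recurrent-*ˡ _ (recurrent-shift s rf))
                             (recurrent-*ˡ _ (recurrent-shift (s ℤ.+ i) rf))
          in-j₀ : f (s ℤ.+ i) * f (s ℤ.+ + 0) - f s * f (s ℤ.+ i ℤ.+ + 0) ≈ 0#
          in-j₀ = trans (reflexive (cong₂ (λ u v → f (s ℤ.+ i) * f u - f s * f v)
                                           (ℤ.+-identityʳ s) (ℤ.+-identityʳ (s ℤ.+ i))))
                        (x*y-y*x≈0 (f (s ℤ.+ i)) (f s))
          in-i : Recurrent (λ i → f (s ℤ.+ i) * f (s ℤ.+ + 1) - f s * f (s ℤ.+ i ℤ.+ + 1))
          in-i = recurrent-− (recurrent-*ʳ _ (recurrent-shift s rf))
                             (recurrent-*ˡ _ (recurrent-shift s (recurrent-+1 rf)))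
          in-i₀ : f (s ℤ.+ + 0) * f (s ℤ.+ + 1) - f s * f (s ℤ.+ + 0 ℤ.+ + 1) ≈ 0#
          in-i₀ = trans (reflexive (cong (λ u → f u * f (s ℤ.+ + 1) - f s * f (u ℤ.+ + 1))
                                         (ℤ.+-identityʳ s)))
                        (-‿inverseʳ _)
          in-i₁ : f (s ℤ.+ + 1) * f (s ℤ.+ + 1) - f s * f (s ℤ.+ + 1 ℤ.+ + 1) ≈ cassini f s
          in-i₁ = reflexive (≡.trans (cong (λ u → f u * f u - f s * f (u ℤ.+ + 1)) (+1≡sucℤ s))
                                     (cong (λ u → f (sucℤ s) * f (sucℤ s) - f s * f u) (+1≡sucℤ (sucℤ s))))

  discriminant : (p q r a b c x : Carrier) → Carrier
  discriminant p q r a b c x = ((q * q) + - (a * p * q)) * (x * x)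
    + ((1# + 1#) * q * r + - (a * p * r) + - (b * p * q)) * x
    + (r * r + - (b * p * r) + - (c * p * p))

  seqP-cassini₀ : ∀ p q r a b c c⁻¹ x →
                  cassini (a * x + b) c (seqP R p q r a b c c⁻¹ x) (+ 0) ≈ discriminant p q r a b c x
  seqP-cassini₀ p q r a b c _ x = solve 7 (λ p q r a b c x →
      ((q :* x :+ r) :* (q :* x :+ r) :- (p :* ((a :* x :+ b) :* (q :* x :+ r) :+ c :* p)))
      := (((q :* q) :- (a :* p :* q)) :* (x :* x)
        :+ ((con (+ 1) :+ con (+ 1)) :* q :* r :- (a :* p :* r) :- (b :* p :* q)) :* x
        :+ (r :* r :- (b :* p :* r) :- (c :* p :* p))))
      refl p q r a b c x

  module _ (p q r a b c c⁻¹ x : Carrier) (c*c⁻¹≈1 : c * c⁻¹ ≈ 1#) where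

    private
      backward-step : ∀ u v → v ≈ (a * x + b) * u + c * (- ((a * x + b) * c⁻¹) * u + c⁻¹ * v)
      backward-step u v = sym (begin
        L * u + c * (- (L * c⁻¹) * u + c⁻¹ * v)         ≈⟨ solve 5 (λ L u v c c⁻¹ →
                                                             (L :* u :+ c :* (:- (L :* c⁻¹) :* u :+ c⁻¹ :* v))
                                                             := (L :* u :- ((c :* c⁻¹) :* (L :* u)) :+ (c :* c⁻¹) :* v))
                                                             refl L u v c c⁻¹ ⟩
        L * u - (c * c⁻¹) * (L * u) + (c * c⁻¹) * v     ≈⟨ +-cong (+-congˡ (-‿cong (*-congʳ c*c⁻¹≈1))) (*-congʳ c*c⁻¹≈1) ⟩
        L * u - 1# * (L * u) + 1# * v                   ≈⟨ +-cong (+-congˡ (-‿cong (*-identityˡ (L * u)))) (*-identityˡ v) ⟩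
        L * u - L * u + v                               ≈⟨ +-congʳ (-‿inverseʳ (L * u)) ⟩
        0# + v                                          ≈⟨ +-identityˡ v ⟩
        v                                               ∎)
        where L = a * x + b

    seqP-recurrent : Recurrent (a * x + b) c (seqP R p q r a b c c⁻¹ x)
    seqP-recurrent (+ n)                = refl
    seqP-recurrent -[1+ zero ]          = backward-step _ _
    seqP-recurrent -[1+ suc zero ]      = backward-step _ _
    seqP-recurrent -[1+ suc (suc n) ]   = backward-step _ _

corollary1 : ∀ {ℓ₁ ℓ₂} (R : CommutativeRing ℓ₁ ℓ₂) →
    let open CommutativeRing R hiding (zero) in
    (p q r a b c cinv x : Carrier) →
    c * cinv ≈ 1# →
    let P : ℤ → Carrier
        P = seqP R p q r a b c cinv x
        U : ℤ → Carrier
        U = seqP R 0# 0# 1# a b c cinv x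
        Δ : Carrier
        Δ = ((q * q) + - (a * p * q)) * (x * x)
            + ((1# + 1#) * q * r + - (a * p * r) + - (b * p * q)) * x
            + (r * r + - (b * p * r) + - (c * p * p))
    in ((j : ℤ) → P j * P (ℤ.+ 1) + - (P (ℤ.+ 0) * P (j ℤ.+ ℤ.+ 1)) ≈ Δ * U j)
       × ((s i j : ℤ) →
            P (s ℤ.+ i) * P (s ℤ.+ j) + - (P s * P (s ℤ.+ i ℤ.+ j))
              ≈ zpow R (- c) (- cinv) s * Δ * U i * U j)
corollary1 R p q r a b c cinv x c*cinv≈1 = part₁ , part₂
  where
  open CommutativeRing R hiding (zero)
  open Recurrences R
  open import Relation.Binary.Reasoning.Setoid setoid

  L : Carrier
  L = a * x + b

  P U : ℤ → Carrier
  P = seqP R p q r a b c cinv x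
  U = seqP R 0# 0# 1# a b c cinv x

  Δ : Carrier
  Δ = discriminant p q r a b c x

  P-rec : Recurrent L c P
  P-rec = seqP-recurrent p q r a b c cinv x c*cinv≈1

  U₁ : U (+ 1) ≈ 1#
  U₁ = trans (+-congʳ (zeroˡ x)) (+-identityˡ 1#)

  catalan-P : ∀ s i j → P (s ℤ.+ i) * P (s ℤ.+ j) - P s * P (s ℤ.+ i ℤ.+ j) ≈ cassini L c P s * U i * U j
  catalan-P = catalan L c c*cinv≈1 (seqP-recurrent 0# 0# 1# a b c cinv x c*cinv≈1) refl U₁ P-rec

  part₁ : ∀ j → P j * P (+ 1) - P (+ 0) * P (j ℤ.+ + 1) ≈ Δ * U j
  part₁ j = begin
    P j * P (+ 1) - P (+ 0) * P (j ℤ.+ + 1)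
      ≡⟨ cong (λ i → P i * P (+ 1) - P (+ 0) * P (i ℤ.+ + 1)) (ℤ.+-identityˡ j) ⟨
    P (+ 0 ℤ.+ j) * P (+ 1) - P (+ 0) * P (+ 0 ℤ.+ j ℤ.+ + 1)
      ≈⟨ catalan-P (+ 0) j (+ 1) ⟩
    cassini L c P (+ 0) * U j * U (+ 1)
      ≈⟨ *-cong (*-congʳ (seqP-cassini₀ p q r a b c cinv x)) U₁ ⟩
    Δ * U j * 1#
      ≈⟨ *-identityʳ (Δ * U j) ⟩
    Δ * U j
      ∎

  part₂ : ∀ s i j → P (s ℤ.+ i) * P (s ℤ.+ j) - P s * P (s ℤ.+ i ℤ.+ j) ≈ zpow R (- c) (- cinv) s * Δ * U i * U j
  part₂ s i j = trans (catalan-P s i j)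
    (*-congʳ (*-congʳ (trans (cassini≈zpow L c c*cinv≈1 P-rec s) (*-congˡ (seqP-cassini₀ p q r a b c cinv x)))))
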